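{- For every positive integer $k$ there is a graph $G$ with $\mathrm{mad}(G)<4$ and $s(G)>k$, and there is also a graph $G$ with $\mathrm{mad}(G)<4$ and $a(G)>k$.
   Context: Graphs are finite and simple; $\mathrm{mad}(G)=\max_{H\subseteq G}\frac{2|E(H)|}{|V(H)|}$ over nonempty subgraphs $H$. $a(G)$ is the minimum number of colors in an acyclic coloring (proper coloring in which the union of any two color classes induces a forest). $s(G)$ is the minimum number of colors in a star coloring (proper coloring with no path on four vertices receiving only two colors). -}

module Defs where

open import Data.Nat using (ℕ; zero; suc; _+_; _*_; _<_; _≤_)
import Data.Nat
import Data.Fin
open import Data.Fin using (Fin; toℕ) renaming (suc to fsuc; zero to fzero)
open import Data.Fin.Subset using (Subset; _∈_; Nonempty)
open import Data.Fin.Subset using (∣_∣)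
open import Data.Bool using (Bool; true; false; T)
open import Data.Vec using (Vec; lookup)
open import Data.List using (List; length; filter)
open import Data.List using (allFin; concatMap; map)
open import Data.Product using (Σ; _×_; _,_; ∃)
open import Relation.Binary.PropositionalEquality using (_≡_; _≢_)
open import Relation.Nullary using (¬_; Dec; yes; no)
open import Relation.Nullary.Decidable using (_×-dec_)
open import Function.Definitions using (Injective)

record Graph : Set where
  field
    n     : ℕ
    adj   : Fin n → Fin n → Bool
    sym   : ∀ u v → adj u v ≡ adj v u
    irrefl : ∀ v → adj v v ≡ false

open Graph public

Adj : (G : Graph) → Fin (n G) → Fin (n G) → Set
Adj G u v = T (adj G u v)

inducedEdges : (G : Graph) → Subset (n G) → ℕ
inducedEdges G S =
  length (filter (λ p → dec (Data.Product.proj₁ p) (Data.Product.proj₂ p))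
                 (concatMap (λ i → map (λ j → (i , j)) (allFin (n G))) (allFin (n G))))
  where
  open import Data.Fin using (_<?_)
  open import Data.Fin.Subset.Properties using (_∈?_)
  open import Data.Bool using (_≟_)
  dec : (i j : Fin (n G)) → Dec ((i ∈ S × j ∈ S) × ((i Data.Fin.< j) × (adj G i j ≡ true)))
  dec i j = ((i ∈? S) ×-dec (j ∈? S)) ×-dec ((i <? j) ×-dec (adj G i j ≟ true))

-- mad(G) < d  (d a natural number): every nonempty (induced) subgraph H
-- satisfies 2|E(H)|/|V(H)| < d, i.e. 2|E(H)| < d·|V(H)|.
-- (The maximum over all subgraphs equals the maximum over induced ones.)
madLessThan : Graph → ℕ → Set
madLessThan G d = (S : Subset (n G)) → Nonempty S →
  2 * inducedEdges G S Data.Nat.< d * ∣ S ∣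

Proper : (G : Graph) (k : ℕ) → (Fin (n G) → Fin k) → Set
Proper G k c = ∀ u v → Adj G u v → c u ≢ c v

-- Star coloring: proper, and no path v1 v2 v3 v4 (distinct vertices)
-- receiving only two colors (in a proper coloring: c v1 = c v3 and c v2 = c v4).
IsStarColoring : (G : Graph) (k : ℕ) → (Fin (n G) → Fin k) → Set
IsStarColoring G k c = Proper G k c ×
  (∀ (v : Vec (Fin (n G)) 4) → Injective _≡_ _≡_ (lookup v) →
     Adj G (lookup v fzero) (lookup v (fsuc fzero)) →
     Adj G (lookup v (fsuc fzero)) (lookup v (fsuc (fsuc fzero))) →
     Adj G (lookup v (fsuc (fsuc fzero))) (lookup v (fsuc (fsuc (fsuc fzero)))) →
     ¬ (c (lookup v fzero) ≡ c (lookup v (fsuc (fsuc fzero))) ×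
        c (lookup v (fsuc fzero)) ≡ c (lookup v (fsuc (fsuc (fsuc fzero))))))

next : ∀ {m} → Fin (suc m) → Fin (suc m)
next {m} i with toℕ i Data.Nat.<? m
... | yes p = Data.Fin.fromℕ< (Data.Nat.s≤s p)
... | no _  = fzero

record Cycle (G : Graph) : Set where
  field
    len   : ℕ
    verts : Vec (Fin (n G)) (3 + len)
    distinct : Injective _≡_ _≡_ (lookup verts)
    edges : ∀ (i : Fin (3 + len)) → Adj G (lookup verts i) (lookup verts (next i))

-- Acyclic coloring: proper, and the union of any two color classes induces
-- a forest, i.e. no cycle of G has all its vertices colored from {a, b}.
IsAcyclicColoring : (G : Graph) (k : ℕ) → (Fin (n G) → Fin k) → Set
IsAcyclicColoring G k c = Proper G k c ×
  (∀ (a b : Fin k) (C : Cycle G) → ¬ (∀ i →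
     let w = c (lookup (Cycle.verts C) i) in (w ≡ a) Data.Sum.⊎ (w ≡ b)))
  where import Data.Sum

StarChromaticGreaterThan : Graph → ℕ → Set
StarChromaticGreaterThan G k = ¬ (Σ (Fin (n G) → Fin k) (IsStarColoring G k))

AcyclicChromaticGreaterThan : Graph → ℕ → Set
AcyclicChromaticGreaterThan G k = ¬ (Σ (Fin (n G) → Fin k) (IsAcyclicColoring G k))

-- Take m = k + 1 corner vertices and join every pair of corners u, v by
-- k + 1 paths of length two.  Numbering the middle vertices first, every
-- vertex has at most two neighbours later in the numbering, so every induced
-- subgraph H has |E(H)| ≤ 2(|V(H)| − 1) and mad < 4.  In a colouring with k
-- colours two corners u, v share a colour, and two middle vertices of u–v
-- paths share a colour; these four vertices form a 4-cycle in two colours,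
-- which is forbidden both in a star colouring (it contains a bicoloured P₄)
-- and in an acyclic colouring.
module Submission where

open import Defs hiding (sym)
open import Data.Nat using (ℕ; zero; suc; _+_; _*_; _≤_; _<_; z≤n; s≤s; z<s)
open import Data.Nat.Properties
  using (≤-refl; ≤-reflexive; ≤-trans; <-asym; ≤⇒≯; n≤1+n; n<1+n; m≤m+n; m<n+m;
         +-assoc; +-suc; +-identityʳ; +-mono-≤; +-monoˡ-≤; +-monoʳ-≤;
         *-assoc; *-suc; *-zeroʳ; *-monoʳ-≤; *-monoʳ-<; +-commutativeSemigroup; module ≤-Reasoning)
open import Data.Nat.ListAction using (sum)
open import Data.Fin using (Fin; toℕ; splitAt; join; _↑ˡ_; _↑ʳ_; combine; remQuot)
  renaming (zero to fzero; suc to fsuc)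
import Data.Fin as F
open import Data.Fin.Properties
  using (_≟_; splitAt-join; join-splitAt; toℕ-↑ˡ; toℕ-↑ʳ; toℕ<n; ↑ˡ-injective;
         ↑ʳ-injective; combine-injectiveʳ; remQuot-combine; pigeonhole; <⇒≢;
         0≢1+n; suc-injective)
open import Data.Fin.Subset using (Subset; _∈_; Nonempty; ∣_∣)
open import Data.Fin.Subset.Properties using (nonempty?)
open import Data.Bool using (Bool; true; false; if_then_else_; T)
open import Data.Bool.Properties using (T-≡)
open import Data.List using (List; []; _∷_; _++_; length; filter; map; tabulate; concatMap; allFin)
open import Data.List.Properties
  using (filter-++; filter-accept; filter-none; length-++; map-tabulate; tabulate-cong)
open import Data.List.Relation.Unary.All.Properties using (tabulate⁺)
open import Data.Vec using (Vec; lookup; here; there) renaming (_∷_ to _∷ᵥ_; [] to []ᵥ)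
open import Data.Vec.Properties using ([]=⇒lookup)
open import Data.Vec.Relation.Unary.All using () renaming (_∷_ to _∷ᵃ_; [] to []ᵃ)
open import Data.Vec.Relation.Unary.AllPairs using () renaming (_∷_ to _∷ᵖ_; [] to []ᵖ)
open import Data.Vec.Relation.Unary.Unique.Propositional using (Unique)
open import Data.Vec.Relation.Unary.Unique.Propositional.Properties using (lookup-injective)
open import Data.Product using (Σ; _×_; _,_; proj₁; proj₂; ∃; map₂)
open import Data.Sum using (_⊎_; inj₁; inj₂)
open import Data.Empty using (⊥-elim)
open import Function using (_∘_; id; Equivalence)
open import Function.Definitions using (Injective)
open import Relation.Nullary using (¬_; Dec; yes; no)
open import Relation.Nullary.Decidable using (_×-dec_; _⊎-dec_; ¬?; isYes; toWitness; fromWitness)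
open import Relation.Unary using (Decidable)
open import Relation.Binary.PropositionalEquality
  using (_≡_; _≢_; refl; sym; trans; cong; subst₂; module ≡-Reasoning)
open import Algebra.Properties.CommutativeSemigroup +-commutativeSemigroup using (x∙yz≈y∙xz)

module _ {A : Set} {P : A → Set} (P? : Decidable P) where

  length-filter-tabulate-none : ∀ {N} (f : Fin N → A) → (∀ i → ¬ P (f i)) →
    length (filter P? (tabulate f)) ≡ 0
  length-filter-tabulate-none f none = cong length (filter-none P? (tabulate⁺ none))

  length-filter-tabulate-≤1 : ∀ {N} (f : Fin N → A) →
    (∀ {i j} → P (f i) → P (f j) → i ≡ j) → length (filter P? (tabulate f)) ≤ 1
  length-filter-tabulate-≤1 {zero}  f unique = z≤n
  length-filter-tabulate-≤1 {suc N} f unique with P? (f fzero)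
  ... | yes p = s≤s (≤-reflexive
          (length-filter-tabulate-none (f ∘ fsuc) (λ i q → 0≢1+n (unique p q))))
  ... | no _  = length-filter-tabulate-≤1 (f ∘ fsuc) (λ p q → suc-injective (unique p q))

  length-filter-map : {B : Set} (f : B → A) (xs : List B) →
    length (filter P? (map f xs)) ≡ length (filter (P? ∘ f) xs)
  length-filter-map f []       = refl
  length-filter-map f (x ∷ xs) with P? (f x)
  ... | yes _ = cong suc (length-filter-map f xs)
  ... | no _  = length-filter-map f xs

  length-filter-concatMap : {B : Set} (f : B → List A) (xs : List B) →
    length (filter P? (concatMap f xs)) ≡ sum (map (length ∘ filter P? ∘ f) xs)
  length-filter-concatMap f []       = refl
  length-filter-concatMap f (x ∷ xs) = begin
    length (filter P? (f x ++ concatMap f xs))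
      ≡⟨ cong length (filter-++ P? (f x) (concatMap f xs)) ⟩
    length (filter P? (f x) ++ filter P? (concatMap f xs))
      ≡⟨ length-++ (filter P? (f x)) ⟩
    length (filter P? (f x)) + length (filter P? (concatMap f xs))
      ≡⟨ cong (length (filter P? (f x)) +_) (length-filter-concatMap f xs) ⟩
    sum (map (length ∘ filter P? ∘ f) (x ∷ xs)) ∎
    where open ≡-Reasoning

  length-filter-∷ : ∀ x xs → length (filter P? xs) ≤ length (filter P? (x ∷ xs))
  length-filter-∷ x xs with P? x
  ... | yes _ = n≤1+n _
  ... | no _  = ≤-refl

module _ {A : Set} {P Q R : A → Set} (P? : Decidable P) (Q? : Decidable Q) (R? : Decidable R)
         (P⊆Q∪R : ∀ x → P x → Q x ⊎ R x) where

  length-filter-∪ : ∀ xs →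
    length (filter P? xs) ≤ length (filter Q? xs) + length (filter R? xs)
  length-filter-∪ []       = z≤n
  length-filter-∪ (x ∷ xs) with P? x
  ... | no _  = ≤-trans (length-filter-∪ xs)
                  (+-mono-≤ (length-filter-∷ Q? x xs) (length-filter-∷ R? x xs))
  ... | yes p with P⊆Q∪R x p
  ...   | inj₁ q rewrite filter-accept Q? {xs = xs} q =
            s≤s (≤-trans (length-filter-∪ xs) (+-monoʳ-≤ _ (length-filter-∷ R? x xs)))
  ...   | inj₂ r rewrite filter-accept R? {xs = xs} r =
            ≤-trans (s≤s (≤-trans (length-filter-∪ xs) (+-monoˡ-≤ _ (length-filter-∷ Q? x xs))))
                    (≤-reflexive (sym (+-suc _ _)))

length-filter-allFin-≤-cover : ∀ {d N} {P : Fin N → Set} (P? : Decidable P) (h : Fin d → Fin N) →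
  (∀ j → P j → ∃ λ x → j ≡ h x) → length (filter P? (allFin N)) ≤ d
length-filter-allFin-≤-cover {zero} P? h cover =
  ≤-reflexive (length-filter-tabulate-none P? id (λ j p → noWitness (cover j p)))
  where noWitness : ∀ {j} → ¬ ∃ λ x → j ≡ h x
        noWitness (() , _)
length-filter-allFin-≤-cover {suc d} {N} {P} P? h cover =
  ≤-trans (length-filter-∪ P? (_≟ h fzero) P′? split (allFin N))
          (+-mono-≤ (length-filter-tabulate-≤1 (_≟ h fzero) id (λ p q → trans p (sym q)))
                    (length-filter-allFin-≤-cover P′? (h ∘ fsuc) cover′))
  where
  P′ : Fin N → Set
  P′ j = P j × j ≢ h fzero
  P′? : Decidable P′
  P′? j = P? j ×-dec ¬? (j ≟ h fzero)
  split : ∀ j → P j → j ≡ h fzero ⊎ P′ j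
  split j p with j ≟ h fzero
  ... | yes j≡h₀ = inj₁ j≡h₀
  ... | no  j≢h₀ = inj₂ (p , j≢h₀)
  cover′ : ∀ j → P′ j → ∃ λ x → j ≡ h (fsuc x)
  cover′ j (p , j≢h₀) with cover j p
  ... | fzero  , j≡h₀ = ⊥-elim (j≢h₀ j≡h₀)
  ... | fsuc x , j≡hx = x , j≡hx

sum-tabulate-mono : ∀ {N} (f g : Fin N → ℕ) → (∀ i → f i ≤ g i) →
  sum (tabulate f) ≤ sum (tabulate g)
sum-tabulate-mono {zero}  f g f≤g = z≤n
sum-tabulate-mono {suc N} f g f≤g =
  +-mono-≤ (f≤g fzero) (sum-tabulate-mono (f ∘ fsuc) (g ∘ fsuc) (f≤g ∘ fsuc))

sum-tabulate-mono-gap : ∀ {N} (f g : Fin N → ℕ) → (∀ i → f i ≤ g i) →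
  ∀ c M → c + f M ≤ g M → c + sum (tabulate f) ≤ sum (tabulate g)
sum-tabulate-mono-gap {suc N} f g f≤g c fzero gap = begin
  c + (f fzero + sum (tabulate (f ∘ fsuc)))  ≡⟨ +-assoc c _ _ ⟨
  c + f fzero + sum (tabulate (f ∘ fsuc))
    ≤⟨ +-mono-≤ gap (sum-tabulate-mono _ _ (f≤g ∘ fsuc)) ⟩
  sum (tabulate g)                           ∎
  where open ≤-Reasoning
sum-tabulate-mono-gap {suc N} f g f≤g c (fsuc M) gap = begin
  c + (f fzero + sum (tabulate (f ∘ fsuc)))  ≡⟨ x∙yz≈y∙xz c (f fzero) _ ⟩
  f fzero + (c + sum (tabulate (f ∘ fsuc)))
    ≤⟨ +-mono-≤ (f≤g fzero)
                (sum-tabulate-mono-gap (f ∘ fsuc) (g ∘ fsuc) (f≤g ∘ fsuc) c M gap) ⟩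
  sum (tabulate g)                           ∎
  where open ≤-Reasoning

sum-tabulate-if-lookup : ∀ {N} (S : Subset N) c →
  sum (tabulate (λ i → if lookup S i then c else 0)) ≡ c * ∣ S ∣
sum-tabulate-if-lookup []ᵥ          c = sym (*-zeroʳ c)
sum-tabulate-if-lookup (true ∷ᵥ S)  c =
  trans (cong (c +_) (sum-tabulate-if-lookup S c)) (sym (*-suc c ∣ S ∣))
sum-tabulate-if-lookup (false ∷ᵥ S) c = sum-tabulate-if-lookup S c

maximum : ∀ {N} (S : Subset N) → Nonempty S → ∃ λ M → M ∈ S × (∀ j → j ∈ S → j F.≤ M)
maximum (b ∷ᵥ S) nonempty with nonempty? S
... | yes nonempty′ with maximum S nonempty′
...   | M , M∈S , max = fsuc M , there M∈S , λ
        { fzero    _          → z≤n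
        ; (fsuc j) (there j∈S) → s≤s (max j j∈S) }
maximum (b ∷ᵥ S) (fzero , here) | no empty = fzero , here , λ
        { fzero    _          → z≤n
        ; (fsuc j) (there j∈S) → ⊥-elim (empty (j , j∈S)) }
maximum (b ∷ᵥ S) (fsuc i , there i∈S) | no empty = ⊥-elim (empty (i , i∈S))

-- The vertex numbering is the degeneracy order; the later neighbours of a
-- vertex are listed, possibly with repetitions, by a function from Fin d.
IsDegenerate : Graph → ℕ → Set
IsDegenerate G d = ∀ i →
  Σ (Fin d → Fin (n G)) λ later → ∀ j → i F.< j → Adj G i j → ∃ λ x → j ≡ later x

-- Parametrising over the decision procedure lets the one hidden inside
-- inducedEdges be found by unification.
InducedEdge : (G : Graph) → Subset (n G) → Fin (n G) × Fin (n G) → Set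
InducedEdge G S (i , j) = (i ∈ S × j ∈ S) × (i F.< j × adj G i j ≡ true)

module _ (G : Graph) (S : Subset (n G)) (E? : Decidable (InducedEdge G S)) where

  edgeCount : ℕ
  edgeCount = length (filter E? (concatMap (λ i → map (i ,_) (allFin (n G))) (allFin (n G))))

  laterDegree : Fin (n G) → ℕ
  laterDegree i = length (filter (E? ∘ (i ,_)) (allFin (n G)))

  edgeCount≡sum-laterDegree : edgeCount ≡ sum (tabulate laterDegree)
  edgeCount≡sum-laterDegree = begin
    edgeCount
      ≡⟨ length-filter-concatMap E? _ (allFin (n G)) ⟩
    sum (map (λ i → length (filter E? (map (i ,_) (allFin (n G))))) (allFin (n G)))
      ≡⟨ cong sum (map-tabulate id (λ i → length (filter E? (map (i ,_) (allFin (n G)))))) ⟩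
    sum (tabulate (λ i → length (filter E? (map (i ,_) (allFin (n G))))))
      ≡⟨ cong sum (tabulate-cong (λ i → length-filter-map E? (i ,_) (allFin (n G)))) ⟩
    sum (tabulate laterDegree) ∎
    where open ≡-Reasoning

  laterDegree-∉ : ∀ i → lookup S i ≡ false → laterDegree i ≡ 0
  laterDegree-∉ i i∉S = length-filter-tabulate-none (E? ∘ (i ,_)) id
    λ j ((i∈S , _) , _) → true≢false (trans (sym ([]=⇒lookup i∈S)) i∉S)
    where true≢false : true ≢ false
          true≢false ()

  laterDegree-maximum : ∀ M → (∀ j → j ∈ S → j F.≤ M) → laterDegree M ≡ 0
  laterDegree-maximum M max = length-filter-tabulate-none (E? ∘ (M ,_)) id
    λ j ((_ , j∈S) , M<j , _) → ≤⇒≯ (max j j∈S) M<j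

  laterDegree-≤ : ∀ {d} → IsDegenerate G d → ∀ i → laterDegree i ≤ d
  laterDegree-≤ degenerate i with degenerate i
  ... | later , covered = length-filter-allFin-≤-cover (E? ∘ (i ,_)) later
    λ j (_ , i<j , i~j) → covered j i<j (Equivalence.from T-≡ i~j)

  twice-edgeCount< : ∀ {d} → IsDegenerate G (suc d) → Nonempty S →
    2 * edgeCount < 2 * suc d * ∣ S ∣
  twice-edgeCount< {d} degenerate nonempty with maximum S nonempty
  ... | M , M∈S , max = begin-strict
    2 * edgeCount            <⟨ *-monoʳ-< 2 (m<n+m edgeCount z<s) ⟩
    2 * (suc d + edgeCount)  ≤⟨ *-monoʳ-≤ 2 bound ⟩
    2 * (suc d * ∣ S ∣)      ≡⟨ *-assoc 2 (suc d) ∣ S ∣ ⟨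
    2 * suc d * ∣ S ∣        ∎
    where
    open ≤-Reasoning
    weight : Fin (n G) → ℕ
    weight i = if lookup S i then suc d else 0
    laterDegree≤weight : ∀ i → laterDegree i ≤ weight i
    laterDegree≤weight i with lookup S i in i∈?S
    ... | true  = laterDegree-≤ degenerate i
    ... | false = ≤-reflexive (laterDegree-∉ i i∈?S)
    gap : suc d + laterDegree M ≤ weight M
    gap rewrite laterDegree-maximum M max | []=⇒lookup M∈S = ≤-reflexive (+-identityʳ (suc d))
    bound : suc d + edgeCount ≤ suc d * ∣ S ∣
    bound = begin
      suc d + edgeCount                  ≡⟨ cong (suc d +_) edgeCount≡sum-laterDegree ⟩
      suc d + sum (tabulate laterDegree)
        ≤⟨ sum-tabulate-mono-gap _ weight laterDegree≤weight (suc d) M gap ⟩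
      sum (tabulate weight)              ≡⟨ sum-tabulate-if-lookup S (suc d) ⟩
      suc d * ∣ S ∣                      ∎

degenerate⇒madLessThan : ∀ {d} (G : Graph) → IsDegenerate G (suc d) → madLessThan G (2 * suc d)
degenerate⇒madLessThan G degenerate S = twice-edgeCount< G S _ degenerate

module _ {G : Graph} {k : ℕ} {c : Fin (n G) → Fin k} where

  record Bicoloured4Cycle : Set where
    field
      w₀ w₁ w₂ w₃ : Fin (n G)
      distinct : Unique (w₀ ∷ᵥ w₁ ∷ᵥ w₂ ∷ᵥ w₃ ∷ᵥ []ᵥ)
      w₀~w₁ : Adj G w₀ w₁
      w₁~w₂ : Adj G w₁ w₂
      w₂~w₃ : Adj G w₂ w₃
      w₃~w₀ : Adj G w₃ w₀
      c₀≡c₂ : c w₀ ≡ c w₂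
      c₁≡c₃ : c w₁ ≡ c w₃

    vertices : Vec (Fin (n G)) 4
    vertices = w₀ ∷ᵥ w₁ ∷ᵥ w₂ ∷ᵥ w₃ ∷ᵥ []ᵥ

    lookup-vertices-injective : Injective _≡_ _≡_ (lookup vertices)
    lookup-vertices-injective {i} {j} = lookup-injective distinct i j

    cycle : Cycle G
    cycle = record { len = 1 ; verts = vertices ; distinct = lookup-vertices-injective ; edges = edges }
      where
      edges : ∀ i → Adj G (lookup vertices i) (lookup vertices (next i))
      edges fzero                      = w₀~w₁
      edges (fsuc fzero)               = w₁~w₂
      edges (fsuc (fsuc fzero))        = w₂~w₃
      edges (fsuc (fsuc (fsuc fzero))) = w₃~w₀

    ¬isStarColoring : ¬ IsStarColoring G k c
    ¬isStarColoring (_ , noBicolouredP₄) =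
      noBicolouredP₄ vertices lookup-vertices-injective w₀~w₁ w₁~w₂ w₂~w₃ (c₀≡c₂ , c₁≡c₃)

    ¬isAcyclicColoring : ¬ IsAcyclicColoring G k c
    ¬isAcyclicColoring (_ , noBicolouredCycle) = noBicolouredCycle (c w₀) (c w₁) cycle colours
      where
      colours : ∀ i → c (lookup vertices i) ≡ c w₀ ⊎ c (lookup vertices i) ≡ c w₁
      colours fzero                      = inj₁ refl
      colours (fsuc fzero)               = inj₂ refl
      colours (fsuc (fsuc fzero))        = inj₁ (sym c₀≡c₂)
      colours (fsuc (fsuc (fsuc fzero))) = inj₂ (sym c₁≡c₃)

open Bicoloured4Cycle using (¬isStarColoring; ¬isAcyclicColoring)

↑ˡ<↑ʳ : ∀ {a b} (i : Fin a) (j : Fin b) → i ↑ˡ b F.< a ↑ʳ j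
↑ˡ<↑ʳ {a} {b} i j = begin-strict
  toℕ (i ↑ˡ b)  ≡⟨ toℕ-↑ˡ i b ⟩
  toℕ i         <⟨ toℕ<n i ⟩
  a             ≤⟨ m≤m+n a (toℕ j) ⟩
  a + toℕ j     ≡⟨ toℕ-↑ʳ a j ⟨
  toℕ (a ↑ʳ j)  ∎
  where open ≤-Reasoning

-- The graph on m corners in which every ordered pair of corners u, v is joined
-- by t paths u – middle u v j – v (a single pendant edge per j when u = v).
-- Vertices are Fin (m * (m * t) + m): middle vertices first, corners last.
module CornersJoinedByPaths (m t : ℕ) where

  #middles : ℕ
  #middles = m * (m * t)

  Middle : Set
  Middle = Fin #middles

  ends : Middle → Fin m × Fin m
  ends e = map₂ (proj₁ ∘ remQuot t) (remQuot (m * t) e)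

  middleIndex : Fin m → Fin m → Fin t → Middle
  middleIndex u v j = combine u (combine v j)

  ends-middleIndex : ∀ u v j → ends (middleIndex u v j) ≡ (u , v)
  ends-middleIndex u v j = begin
    ends (middleIndex u v j)
      ≡⟨ cong (map₂ (proj₁ ∘ remQuot t)) (remQuot-combine u (combine v j)) ⟩
    u , proj₁ (remQuot t (combine v j))  ≡⟨ cong (λ r → u , proj₁ r) (remQuot-combine v j) ⟩
    u , v                                ∎
    where open ≡-Reasoning

  Touches : Middle → Fin m → Set
  Touches e c = c ≡ proj₁ (ends e) ⊎ c ≡ proj₂ (ends e)

  touches? : ∀ e c → Dec (Touches e c)
  touches? e c = (c ≟ proj₁ (ends e)) ⊎-dec (c ≟ proj₂ (ends e))

  adjacent : Middle ⊎ Fin m → Middle ⊎ Fin m → Bool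
  adjacent (inj₁ e) (inj₂ c) = isYes (touches? e c)
  adjacent (inj₂ c) (inj₁ e) = isYes (touches? e c)
  adjacent (inj₁ _) (inj₁ _) = false
  adjacent (inj₂ _) (inj₂ _) = false

  adjacent-sym : ∀ x y → adjacent x y ≡ adjacent y x
  adjacent-sym (inj₁ _) (inj₁ _) = refl
  adjacent-sym (inj₁ _) (inj₂ _) = refl
  adjacent-sym (inj₂ _) (inj₁ _) = refl
  adjacent-sym (inj₂ _) (inj₂ _) = refl

  adjacent-irrefl : ∀ x → adjacent x x ≡ false
  adjacent-irrefl (inj₁ _) = refl
  adjacent-irrefl (inj₂ _) = refl

  graph : Graph
  graph = record
    { n      = #middles + m
    ; adj    = λ i j → adjacent (splitAt #middles i) (splitAt #middles j)
    ; sym    = λ i j → adjacent-sym (splitAt #middles i) (splitAt #middles j)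
    ; irrefl = λ i → adjacent-irrefl (splitAt #middles i)
    }

  vertex : Middle ⊎ Fin m → Fin (n graph)
  vertex = join #middles m

  corner : Fin m → Fin (n graph)
  corner = vertex ∘ inj₂

  middle : Fin m → Fin m → Fin t → Fin (n graph)
  middle u v j = vertex (inj₁ (middleIndex u v j))

  Adj-vertex : ∀ {x y} → T (adjacent x y) → Adj graph (vertex x) (vertex y)
  Adj-vertex {x} {y} = subst₂ (λ x′ y′ → T (adjacent x′ y′))
    (sym (splitAt-join #middles m x)) (sym (splitAt-join #middles m y))

  Adj-corner-middle : ∀ {c e} → Touches e c → Adj graph (corner c) (vertex (inj₁ e))
  Adj-corner-middle {c} {e} touches = Adj-vertex {inj₂ c} {inj₁ e} (fromWitness touches)

  Adj-middle-corner : ∀ {c e} → Touches e c → Adj graph (vertex (inj₁ e)) (corner c)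
  Adj-middle-corner {c} {e} touches = Adj-vertex {inj₁ e} {inj₂ c} (fromWitness touches)

  touches₁ : ∀ u v j → Touches (middleIndex u v j) u
  touches₁ u v j = inj₁ (sym (cong proj₁ (ends-middleIndex u v j)))

  touches₂ : ∀ u v j → Touches (middleIndex u v j) v
  touches₂ u v j = inj₂ (sym (cong proj₂ (ends-middleIndex u v j)))

  corner≢middle : ∀ c e → corner c ≢ vertex (inj₁ e)
  corner≢middle c e eq = inj₂≢inj₁ (begin
    inj₂ c                              ≡⟨ splitAt-join #middles m (inj₂ c) ⟨
    splitAt #middles (corner c)         ≡⟨ cong (splitAt #middles) eq ⟩
    splitAt #middles (vertex (inj₁ e))  ≡⟨ splitAt-join #middles m (inj₁ e) ⟩
    inj₁ e                              ∎)
    where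
    open ≡-Reasoning
    inj₂≢inj₁ : inj₂ c ≢ inj₁ e
    inj₂≢inj₁ ()

  corner-injective : ∀ {u v} → corner u ≡ corner v → u ≡ v
  corner-injective = ↑ʳ-injective _ _ _

  middle-injective : ∀ {u v j j′} → middle u v j ≡ middle u v j′ → j ≡ j′
  middle-injective {u} {v} {j} {j′} eq =
    combine-injectiveʳ v j v j′ (combine-injectiveʳ u _ u _ (↑ˡ-injective m _ _ eq))

  laterCorners : Middle ⊎ Fin m → Fin 2 → Fin (n graph)
  laterCorners (inj₁ e) = lookup (corner (proj₁ (ends e)) ∷ᵥ corner (proj₂ (ends e)) ∷ᵥ []ᵥ)
  laterCorners (inj₂ c) _ = corner c

  laterNeighbour : ∀ x y → vertex x F.< vertex y → T (adjacent x y) →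
    ∃ λ i → vertex y ≡ laterCorners x i
  laterNeighbour (inj₁ e) (inj₂ c) _ touches with toWitness touches
  ... | inj₁ refl = fzero , refl
  ... | inj₂ refl = fsuc fzero , refl
  laterNeighbour (inj₂ c) (inj₁ e) c<e _ = ⊥-elim (<-asym c<e (↑ˡ<↑ʳ e c))

  isDegenerate : IsDegenerate graph 2
  isDegenerate i = laterCorners (splitAt #middles i) , λ j i<j i~j →
    map₂ (trans (sym (join-splitAt #middles m j)))
         (laterNeighbour (splitAt #middles i) (splitAt #middles j) (split-< i<j) i~j)
    where
    split-< : ∀ {i j} → i F.< j → vertex (splitAt #middles i) F.< vertex (splitAt #middles j)
    split-< {i} {j} = subst₂ F._<_ (sym (join-splitAt #middles m i)) (sym (join-splitAt #middles m j))

  bicoloured4Cycle : ∀ {k} → k < m → k < t → (c : Fin (n graph) → Fin k) →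
    Bicoloured4Cycle {graph} {k} {c}
  bicoloured4Cycle k<m k<t c with pigeonhole k<m (c ∘ corner)
  ... | u , v , u<v , cu≡cv with pigeonhole k<t (c ∘ middle u v)
  ... | j₁ , j₂ , j₁<j₂ , cj₁≡cj₂ = record
    { w₀ = corner u ; w₁ = middle u v j₁ ; w₂ = corner v ; w₃ = middle u v j₂
    ; distinct =
        (corner≢middle u _ ∷ᵃ <⇒≢ u<v ∘ corner-injective ∷ᵃ corner≢middle u _ ∷ᵃ []ᵃ)
        ∷ᵖ ((λ eq → corner≢middle v _ (sym eq)) ∷ᵃ <⇒≢ j₁<j₂ ∘ middle-injective ∷ᵃ []ᵃ)
        ∷ᵖ (corner≢middle v _ ∷ᵃ []ᵃ)
        ∷ᵖ []ᵃ
        ∷ᵖ []ᵖ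
    ; w₀~w₁ = Adj-corner-middle (touches₁ u v j₁)
    ; w₁~w₂ = Adj-middle-corner (touches₂ u v j₁)
    ; w₂~w₃ = Adj-corner-middle (touches₂ u v j₂)
    ; w₃~w₀ = Adj-middle-corner (touches₁ u v j₂)
    ; c₀≡c₂ = cu≡cv
    ; c₁≡c₃ = cj₁≡cj₂
    }

proposition7p8 : (k : ℕ) → 1 Data.Nat.≤ k →
    Σ Graph (λ G → madLessThan G 4 × StarChromaticGreaterThan G k) ×
    Σ Graph (λ G → madLessThan G 4 × AcyclicChromaticGreaterThan G k)
proposition7p8 k _ = (graph , mad<4 , noStarColoring) , (graph , mad<4 , noAcyclicColoring)
  where
  open CornersJoinedByPaths (suc k) (suc k)
  mad<4 : madLessThan graph 4
  mad<4 = degenerate⇒madLessThan graph isDegenerate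
  bicoloured : (c : Fin (n graph) → Fin k) → Bicoloured4Cycle {graph} {k} {c}
  bicoloured = bicoloured4Cycle (n<1+n k) (n<1+n k)
  noStarColoring : StarChromaticGreaterThan graph k
  noStarColoring (c , star) = ¬isStarColoring (bicoloured c) star
  noAcyclicColoring : AcyclicChromaticGreaterThan graph k
  noAcyclicColoring (c , acyclic) = ¬isAcyclicColoring (bicoloured c) acyclic
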